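{- Let $(P,A_1,\ldots,A_n)$ be a regular poset of width $w$, $P=(V,\le_P)$, and for $x\in V$ let $A(x)$ be the unique $A_i$ containing $x$. If $L\subseteq V$ induces a $(2w+1)$-ladder in $P$ with lower leg $x_1,\dots,x_{2w+1}$ and upper leg $y_1,\dots,y_{2w+1}$, then $A(y_1)\sqsubseteq_P A(x_{2w+1})$.
   Context: An $m$-ladder is the poset on two disjoint chains $x_1<\dots<x_m$ (lower leg) and $y_1<\dots<y_m$ (upper leg) with $x_i<y_i$ for all $i$, $y_i\parallel x_j$ whenever $i<j$, and all other relations given by transitivity. For a poset $P$ and $B\subseteq P$, $D_P[B]$ is the set of elements that are $\le_P$ some element of $B$. A maximum antichain is an antichain of size equal to the width of $P$. For maximum antichains $A,B$ write $A\sqsubseteq_P B$ if $A\subseteq D_P[B]$, and $A\sqsubset_P B$ if moreover $A\ne B$. A bipartite poset with disjoint antichains $A,B$, $A\sqsubset B$, is a core if $|A|=|B|$ and for every comparable pair $x\le y$ with $x\in A$, $y\in B$ there is a partition of $A\cup B$ into $|A|$ chains in which $x$ and $y$ lie in the same chain. A tuple $(P,A_1,\dots,A_n)$ is a regular poset of width $w$ if $P=(V,\le_P)$ is a finite poset of width $w$ and $A_1,\dots,A_n$ are maximum antichains of $P$ such that: (R1) $V=A_1\cup\dots\cup A_n$; (R2) $A_i\cap A_j=\emptyset$ for $i\ne j$; (R3) $\{A_1,\dots,A_n\}$ is linearly ordered by $\sqsubseteq_P$; for each $i$, let $A_{p(i)}$ be the $\sqsubseteq_P$-greatest among $A_1,\dots,A_{i-1}$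 with $A_{p(i)}\sqsubset_P A_i$ and $A_{s(i)}$ the $\sqsubseteq_P$-least among $A_1,\dots,A_{i-1}$ with $A_i\sqsubset_P A_{s(i)}$ (each undefined if no such antichain exists); (R4) $P[A_i\cup A_{s(i)}]$ is a core whenever $s(i)$ is defined and $P[A_{p(i)}\cup A_i]$ is a core whenever $p(i)$ is defined; (R5) if $x<_P y$ with $x\in A_i$, $y\in A_j$, then if $i>j$ there is $z\in A_{s(i)}$ with $x<_P z\le_P y$, and otherwise there is $z\in A_{p(j)}$ with $x\le_P z<_P y$. -}

module Defs where

open import Level using (0ℓ)
open import Data.Nat as ℕ using (ℕ; suc; _*_)
open import Data.Fin using (Fin; toℕ; zero; fromℕ)
open import Data.Fin.Subset using (Subset; _∈_; _∪_; ∣_∣)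
open import Data.Product using (Σ; _×_; _,_; ∃; ∃-syntax)
open import Data.Sum using (_⊎_)
open import Relation.Binary using (Rel; IsPartialOrder)
open import Relation.Binary.PropositionalEquality using (_≡_; _≢_)
open import Relation.Nullary using (¬_)
open import Function.Bundles using (_⇔_)

-- A finite poset is represented by a partial order _≤_ on Fin N
-- (the vertex set V is Fin N); subsets of V are Data.Fin.Subset.

module _ {N : ℕ} (_≤_ : Rel (Fin N) 0ℓ) where

  _<ₚ_ : Fin N → Fin N → Set
  u <ₚ v = (u ≤ v) × (u ≢ v)

  IsAntichain : Subset N → Set
  IsAntichain A = ∀ u v → u ∈ A → v ∈ A → u ≤ v → u ≡ v

  HasWidth : ℕ → Set
  HasWidth w = (Σ (Subset N) λ A → IsAntichain A × ∣ A ∣ ≡ w)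
             × (∀ A → IsAntichain A → ∣ A ∣ ℕ.≤ w)

  IsMaxAntichain : ℕ → Subset N → Set
  IsMaxAntichain w A = IsAntichain A × ∣ A ∣ ≡ w

  _∈D[_] : Fin N → Subset N → Set
  u ∈D[ B ] = ∃[ b ] (b ∈ B × u ≤ b)

  _⊑_ : Subset N → Subset N → Set
  A ⊑ B = ∀ a → a ∈ A → a ∈D[ B ]

  _⊏_ : Subset N → Subset N → Set
  A ⊏ B = (A ⊑ B) × (A ≢ B)

  IsChainPartition : Subset N → (k : ℕ) → (Fin N → Fin k) → Set
  IsChainPartition S k f =
      (∀ j → ∃[ u ] (u ∈ S × f u ≡ j))
    × (∀ u v → u ∈ S → v ∈ S → f u ≡ f v → (u ≤ v) ⊎ (v ≤ u))

  IsCore : Subset N → Subset N → Set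
  IsCore A B =
      IsAntichain A × IsAntichain B
    × (∀ u → u ∈ A → ¬ (u ∈ B))
    × (A ⊏ B)
    × (∣ A ∣ ≡ ∣ B ∣)
    × (∀ x y → x ∈ A → y ∈ B → x ≤ y →
         Σ (Fin N → Fin ∣ A ∣) λ f →
           IsChainPartition (A ∪ B) ∣ A ∣ f × f x ≡ f y)

  module _ {n : ℕ} (A : Fin n → Subset N) where

    IsPred : Fin n → Fin n → Set
    IsPred i j = (toℕ j ℕ.< toℕ i) × (A j ⊏ A i)
               × (∀ k → toℕ k ℕ.< toℕ i → A k ⊏ A i → A k ⊑ A j)

    IsSucc : Fin n → Fin n → Set
    IsSucc i j = (toℕ j ℕ.< toℕ i) × (A i ⊏ A j)
               × (∀ k → toℕ k ℕ.< toℕ i → A i ⊏ A k → A j ⊑ A k)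

    IsRegular : ℕ → Set
    IsRegular w =
        HasWidth w
      × (∀ i → IsMaxAntichain w (A i))
      × (∀ v → ∃[ i ] (v ∈ A i))
      × (∀ i j → i ≢ j → ∀ v → v ∈ A i → ¬ (v ∈ A j))
      × (∀ i j → (A i ⊑ A j) ⊎ (A j ⊑ A i))
      × (∀ i j → IsSucc i j → IsCore (A i) (A j))
      × (∀ i j → IsPred i j → IsCore (A j) (A i))
      × (∀ i j x y → x ∈ A i → y ∈ A j → x <ₚ y →
           (toℕ j ℕ.< toℕ i →
              ∃[ k ] (IsSucc i k × ∃[ z ] (z ∈ A k × x <ₚ z × z ≤ y)))
         × (toℕ i ℕ.≤ toℕ j →
              ∃[ k ] (IsPred j k × ∃[ z ] (z ∈ A k × x ≤ z × z <ₚ y))))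

  -- x, y (lower and upper leg, indexed 0..m-1) induce an m-ladder in P:
  -- the order of P restricted to {x_i} ∪ {y_i} is exactly the ladder order.
  IsLadder : (m : ℕ) → (Fin m → Fin N) → (Fin m → Fin N) → Set
  IsLadder m x y =
      (∀ i j → (x i ≤ x j) ⇔ (toℕ i ℕ.≤ toℕ j))
    × (∀ i j → (y i ≤ y j) ⇔ (toℕ i ℕ.≤ toℕ j))
    × (∀ i j → (x i ≤ y j) ⇔ (toℕ i ℕ.≤ toℕ j))
    × (∀ i j → ¬ (y i ≤ x j))

-- If instead A(x_{2w+1}) ⊑ A(y_1), let A_t be the antichain of least index between A(x_{w+1}) and
-- A(y_{w+1}). Refining a comparable pair u ≤ v with (R5) eventually passes through any antichain
-- enclosed by A(u) and A(v) that has least index on one side of the enclosure. By (R3) either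
-- A_t ⊑ A(y_1), and then the w+1 lower rungs x_k ≤ y_k (k ≤ w+1) all pass through A_t, or
-- A(x_{2w+1}) ⊑ A(y_1) ⊑ A_t and the w+1 upper rungs do. Distinct rungs of a ladder cannot share an
-- element, so A_t would have more than w elements.
module Submission where

open import Defs
open import Level using (0ℓ)
open import Data.Nat using (ℕ; suc; _*_)
open import Data.Fin using (Fin; zero; fromℕ)
open import Data.Fin.Subset using (Subset; _∈_)
open import Relation.Binary using (Rel; IsPartialOrder)
open import Relation.Binary.PropositionalEquality using (_≡_)

import Data.Bool as Bool
import Data.Nat as ℕ
import Data.Nat.Properties as ℕₚ
open import Data.Nat.Induction using (<-wellFounded)
import Data.Fin as F
open import Data.Fin using (toℕ; fromℕ<; _↑ˡ_)
import Data.Fin.Induction as Fᵢ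
import Data.Fin.Properties as Fₚ
open import Data.Fin.Subset using (∣_∣; _-_)
open import Data.Fin.Subset.Properties using (x∈p∧x≢y⇒x∈p-y; x∈p⇒∣p-x∣<∣p∣)
open import Data.Vec.Properties using (≡-dec)
open import Data.Product using (_×_; _,_; ∃-syntax; proj₁; proj₂)
open import Data.Sum using (_⊎_; inj₁; inj₂)
open import Data.Empty using (⊥-elim)
open import Function using (_∘_; case_of_)
open import Function.Bundles using (Equivalence)
open import Function.Definitions using (Injective)
open import Induction.WellFounded using (Acc; acc)
open import Relation.Nullary using (¬_; yes; no)
open import Relation.Binary.Definitions using (DecidableEquality)
open import Relation.Binary.PropositionalEquality using (_≢_; refl; sym; cong; subst)

injection⇒≤∣p∣ : ∀ {m N} (p : Subset N) (f : Fin m → Fin N) →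
                 (∀ k → f k ∈ p) → Injective _≡_ _≡_ f → m ℕ.≤ ∣ p ∣
injection⇒≤∣p∣ {ℕ.zero} p f f∈p f-inj = ℕ.z≤n
injection⇒≤∣p∣ {suc m}  p f f∈p f-inj =
  ℕₚ.≤-<-trans (injection⇒≤∣p∣ (p - f zero) (f ∘ F.suc) f∘suc∈p-f₀ (Fₚ.suc-injective ∘ f-inj))
               (x∈p⇒∣p-x∣<∣p∣ (f∈p zero))
  where
  f∘suc∈p-f₀ : ∀ k → f (F.suc k) ∈ p - f zero
  f∘suc∈p-f₀ k = x∈p∧x≢y⇒x∈p-y (f∈p (F.suc k)) (Fₚ.0≢1+n ∘ sym ∘ f-inj)

LeastIndex : ∀ {n} → (Fin n → Set) → Fin n → Set
LeastIndex P l = ∀ t → P t → l F.≤ t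

¬¬leastIndex : ∀ {n} {P : Fin n → Set} {t} → P t → ¬ ¬ (∃[ l ] (P l × LeastIndex P l))
¬¬leastIndex {P = P} {t} = go (Fᵢ.<-wellFounded t)
  where
  go : ∀ {t} → Acc F._<_ t → P t → ¬ ¬ (∃[ l ] (P l × LeastIndex P l))
  go {t} (acc smaller) Pt noLeast = noLeast (t , Pt , least)
    where
    least : LeastIndex P t
    least t′ Pt′ with t′ F.<? t
    ... | yes t′<t = ⊥-elim (go (smaller t′<t) Pt′ noLeast)
    ... | no  t′≮t = ℕₚ.≮⇒≥ t′≮t

module Downsets {N : ℕ} {_≤_ : Rel (Fin N) 0ℓ} (po : IsPartialOrder _≡_ _≤_) where

  open IsPartialOrder po using () renaming (reflexive to ≤-reflexive; trans to ≤-trans)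

  ⊑-refl : ∀ {P} → _⊑_ _≤_ P P
  ⊑-refl u u∈P = u , u∈P , ≤-reflexive refl

  ⊑-trans : ∀ {P Q R} → _⊑_ _≤_ P Q → _⊑_ _≤_ Q R → _⊑_ _≤_ P R
  ⊑-trans P⊑Q Q⊑R u u∈P with P⊑Q u u∈P
  ... | v , v∈Q , u≤v with Q⊑R v v∈Q
  ... | z , z∈R , v≤z = z , z∈R , ≤-trans u≤v v≤z

module Regular {N : ℕ} {_≤_ : Rel (Fin N) 0ℓ} (po : IsPartialOrder _≡_ _≤_)
               {w n : ℕ} {A : Fin n → Subset N} (reg : IsRegular _≤_ A w) where

  open IsPartialOrder po using () renaming (antisym to ≤-antisym; reflexive to ≤-reflexive; trans to ≤-trans)
  open Downsets po

  ≤-refl : ∀ {u} → u ≤ u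
  ≤-refl = ≤-reflexive refl

  infix 4 _⊑ᴬ_
  _⊑ᴬ_ : Fin n → Fin n → Set
  a ⊑ᴬ b = _⊑_ _≤_ (A a) (A b)

  antichain : ∀ i → IsAntichain _≤_ (A i)
  antichain i = proj₁ (proj₁ (proj₂ reg) i)

  ∣A∣≡w : ∀ i → ∣ A i ∣ ≡ w
  ∣A∣≡w i = proj₂ (proj₁ (proj₂ reg) i)

  index : Fin N → Fin n
  index u = proj₁ (proj₁ (proj₂ (proj₂ reg)) u)

  ∈-index : ∀ u → u ∈ A (index u)
  ∈-index u = proj₂ (proj₁ (proj₂ (proj₂ reg)) u)

  disjoint : ∀ i j → i ≢ j → ∀ u → u ∈ A i → ¬ (u ∈ A j)
  disjoint = proj₁ (proj₂ (proj₂ (proj₂ reg)))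

  linear : ∀ i j → (i ⊑ᴬ j) ⊎ (j ⊑ᴬ i)
  linear = proj₁ (proj₂ (proj₂ (proj₂ (proj₂ reg))))

  _≟ˢ_ : DecidableEquality (Subset N)
  _≟ˢ_ = ≡-dec Bool._≟_

  ≤⇒⊑ : ∀ {a b u v} → u ≤ v → u ∈ A a → v ∈ A b → a ⊑ᴬ b
  ≤⇒⊑ {a} {b} {u} {v} u≤v u∈a v∈b with linear a b
  ... | inj₁ a⊑b = a⊑b
  ... | inj₂ b⊑a with b⊑a v v∈b
  ... | c , c∈a , v≤c with antichain a u c u∈a c∈a (≤-trans u≤v v≤c)
  ... | refl with ≤-antisym u≤v v≤c
  ... | refl with a F.≟ b
  ... | yes refl = ⊑-refl
  ... | no  a≢b  = ⊥-elim (disjoint a b a≢b u u∈a v∈b)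

  Between : Fin n → Fin n → Fin n → Set
  Between a b t = a ⊑ᴬ t × t ⊑ᴬ b

  Meets : Fin n → Fin N → Fin N → Set
  Meets l u v = ∃[ z ] (z ∈ A l × u ≤ z × z ≤ v)

  meets-source : ∀ {l u v} → u ∈ A l → u ≤ v → Meets l u v
  meets-source u∈l u≤v = _ , u∈l , ≤-refl , u≤v

  meets-target : ∀ {l u v} → v ∈ A l → u ≤ v → Meets l u v
  meets-target v∈l u≤v = _ , v∈l , u≤v , ≤-refl

  meets-extendˡ : ∀ {l u u′ v} → u ≤ u′ → Meets l u′ v → Meets l u v
  meets-extendˡ u≤u′ (z , z∈l , u′≤z , z≤v) = z , z∈l , ≤-trans u≤u′ u′≤z , z≤v

  meets-extendʳ : ∀ {l u v v′} → v′ ≤ v → Meets l u v′ → Meets l u v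
  meets-extendʳ v′≤v (z , z∈l , u≤z , z≤v′) = z , z∈l , u≤z , ≤-trans z≤v′ v′≤v

  meets-point : ∀ {i j l u} → u ∈ A i → u ∈ A j → Between i j l → Meets l u u
  meets-point {j = j} {u = u} u∈i u∈j (i⊑l , l⊑j) with i⊑l u u∈i
  ... | z , z∈l , u≤z with l⊑j z z∈l
  ... | v , v∈j , z≤v with antichain j u v u∈j v∈j (≤-trans u≤z z≤v)
  ... | refl = z , z∈l , u≤z , z≤v

  -- (R5), with the case u ≡ v split off and the strict inequalities weakened.
  data Factor (i j : Fin n) (u v : Fin N) : Set where
    trivial     : u ≡ v → Factor i j u v
    throughSucc : ∀ {s z} → j F.< i → IsSucc _≤_ A i s → z ∈ A s → u ≤ z → z ≤ v → Factor i j u v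
    throughPred : ∀ {p z} → i F.≤ j → IsPred _≤_ A j p → z ∈ A p → u ≤ z → z ≤ v → Factor i j u v

  factor : ∀ {i j u v} → u ∈ A i → v ∈ A j → u ≤ v → Factor i j u v
  factor {i} {j} {u} {v} u∈i v∈j u≤v with u F.≟ v
  ... | yes u≡v = trivial u≡v
  ... | no  u≢v with j F.<? i | proj₂ (proj₂ (proj₂ (proj₂ (proj₂ (proj₂ (proj₂ reg)))))) i j u v u∈i v∈j (u≤v , u≢v)
  ... | yes j<i | r5 , _ with r5 j<i
  ...   | _ , succ , _ , z∈s , (u≤z , _) , z≤v = throughSucc j<i succ z∈s u≤z z≤v
  factor _ _ _ | no _ | no j≮i | _ , r5 with r5 (ℕₚ.≮⇒≥ j≮i)
  ...   | _ , pred , _ , z∈p , u≤z , (z≤v , _) = throughPred (ℕₚ.≮⇒≥ j≮i) pred z∈p u≤z z≤v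

  -- Minimality of l gives l < i (resp. l < j), so A_s(i) ⊑ A_l (resp. A_l ⊑ A_p(j)): refining
  -- through (R5) never jumps over A_l.
  meets-leastAbove : ∀ {i j l u v} → u ∈ A i → v ∈ A j → u ≤ v → Between i j l →
                     LeastIndex (Between l j) l → Meets l u v
  meets-leastAbove {i} {j} = go (<-wellFounded (toℕ i ℕ.+ toℕ j))
    where
    go : ∀ {i j l u v} → Acc ℕ._<_ (toℕ i ℕ.+ toℕ j) → u ∈ A i → v ∈ A j → u ≤ v →
         Between i j l → LeastIndex (Between l j) l → Meets l u v
    go {i} {j} {l} (acc smaller) u∈i v∈j u≤v i⊑l⊑j@(i⊑l , l⊑j) least with factor u∈i v∈j u≤v
    ... | trivial refl = meets-point u∈i v∈j i⊑l⊑j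
    ... | throughSucc j<i (s<i , _ , s-least) z∈s u≤z z≤v with A i ≟ˢ A l
    ...   | yes Aᵢ≡Aₗ = meets-source (subst (_ ∈_) Aᵢ≡Aₗ u∈i) u≤v
    ...   | no  Aᵢ≢Aₗ = meets-extendˡ u≤z
              (go (smaller (ℕₚ.+-monoˡ-< (toℕ j) s<i)) z∈s v∈j z≤v (s⊑l , l⊑j) least)
      where
      l<i : l F.< i
      l<i = ℕₚ.≤-<-trans (least j (l⊑j , ⊑-refl)) j<i
      s⊑l = s-least l l<i (i⊑l , Aᵢ≢Aₗ)
    go {i} {j} {l} (acc smaller) u∈i v∈j u≤v (i⊑l , l⊑j) least
      | throughPred _ (p<j , (p⊑j , _) , p-greatest) z∈p u≤z z≤v with A l ≟ˢ A j
    ...   | yes Aₗ≡Aⱼ = meets-target (subst (_ ∈_) (sym Aₗ≡Aⱼ) v∈j) u≤v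
    ...   | no  Aₗ≢Aⱼ = meets-extendʳ z≤v
              (go (smaller (ℕₚ.+-monoʳ-< (toℕ i) p<j)) u∈i z∈p u≤z (i⊑l , l⊑p) least′)
      where
      l<j : l F.< j
      l<j = Fₚ.≤∧≢⇒< (least j (l⊑j , ⊑-refl)) (Aₗ≢Aⱼ ∘ cong A)
      l⊑p = p-greatest l l<j (l⊑j , Aₗ≢Aⱼ)
      least′ : LeastIndex (Between l _) l
      least′ t (l⊑t , t⊑p) = least t (l⊑t , ⊑-trans t⊑p p⊑j)

  meets-leastBelow : ∀ {i j l u v} → u ∈ A i → v ∈ A j → u ≤ v → Between i j l →
                     LeastIndex (Between i l) l → Meets l u v
  meets-leastBelow {i} {j} = go (<-wellFounded (toℕ i ℕ.+ toℕ j))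
    where
    go : ∀ {i j l u v} → Acc ℕ._<_ (toℕ i ℕ.+ toℕ j) → u ∈ A i → v ∈ A j → u ≤ v →
         Between i j l → LeastIndex (Between i l) l → Meets l u v
    go {i} {j} {l} (acc smaller) u∈i v∈j u≤v i⊑l⊑j@(i⊑l , l⊑j) least with factor u∈i v∈j u≤v
    ... | trivial refl = meets-point u∈i v∈j i⊑l⊑j
    ... | throughSucc _ (s<i , (i⊑s , _) , s-least) z∈s u≤z z≤v with A i ≟ˢ A l
    ...   | yes Aᵢ≡Aₗ = meets-source (subst (_ ∈_) Aᵢ≡Aₗ u∈i) u≤v
    ...   | no  Aᵢ≢Aₗ = meets-extendˡ u≤z
              (go (smaller (ℕₚ.+-monoˡ-< (toℕ j) s<i)) z∈s v∈j z≤v (s⊑l , l⊑j) least′)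
      where
      l<i : l F.< i
      l<i = Fₚ.≤∧≢⇒< (least i (⊑-refl , i⊑l)) (Aᵢ≢Aₗ ∘ sym ∘ cong A)
      s⊑l = s-least l l<i (i⊑l , Aᵢ≢Aₗ)
      least′ : LeastIndex (Between _ l) l
      least′ t (s⊑t , t⊑l) = least t (⊑-trans i⊑s s⊑t , t⊑l)
    go {i} {j} {l} (acc smaller) u∈i v∈j u≤v (i⊑l , l⊑j) least
      | throughPred i≤j (p<j , _ , p-greatest) z∈p u≤z z≤v with A l ≟ˢ A j
    ...   | yes Aₗ≡Aⱼ = meets-target (subst (_ ∈_) (sym Aₗ≡Aⱼ) v∈j) u≤v
    ...   | no  Aₗ≢Aⱼ = meets-extendʳ z≤v
              (go (smaller (ℕₚ.+-monoʳ-< (toℕ i) p<j)) u∈i z∈p u≤z (i⊑l , l⊑p) least)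
      where
      l<j : l F.< j
      l<j = Fₚ.≤∧≢⇒< (ℕₚ.≤-trans (least i (⊑-refl , i⊑l)) i≤j) (Aₗ≢Aⱼ ∘ cong A)
      l⊑p = p-greatest l l<j (l⊑j , Aₗ≢Aⱼ)

  module Rungs {m : ℕ} {x y : Fin m → Fin N} (ladder : IsLadder _≤_ m x y) where

    x-mono : ∀ {a b} → a F.≤ b → x a ≤ x b
    x-mono {a} {b} = Equivalence.from (proj₁ ladder a b)

    y-mono : ∀ {a b} → a F.≤ b → y a ≤ y b
    y-mono {a} {b} = Equivalence.from (proj₁ (proj₂ ladder) a b)

    x≤y : ∀ a → x a ≤ y a
    x≤y a = Equivalence.from (proj₁ (proj₂ (proj₂ ladder)) a a) ℕₚ.≤-refl

    x≤y⇒≤ : ∀ {a b} → x a ≤ y b → a F.≤ b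
    x≤y⇒≤ {a} {b} = Equivalence.to (proj₁ (proj₂ (proj₂ ladder)) a b)

    X Y : Fin m → Fin n
    X = index ∘ x
    Y = index ∘ y

    X⊑X : ∀ {a b} → a F.≤ b → X a ⊑ᴬ X b
    X⊑X a≤b = ≤⇒⊑ (x-mono a≤b) (∈-index _) (∈-index _)

    Y⊑Y : ∀ {a b} → a F.≤ b → Y a ⊑ᴬ Y b
    Y⊑Y a≤b = ≤⇒⊑ (y-mono a≤b) (∈-index _) (∈-index _)

    X⊑Y : ∀ a → X a ⊑ᴬ Y a
    X⊑Y a = ≤⇒⊑ (x≤y a) (∈-index _) (∈-index _)

    meets-sameRung : ∀ {t a b} (ma : Meets t (x a) (y a)) (mb : Meets t (x b) (y b)) →
                     proj₁ ma ≡ proj₁ mb → a ≡ b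
    meets-sameRung (z , _ , xa≤z , z≤ya) (.z , _ , xb≤z , z≤yb) refl =
      Fₚ.≤-antisym (x≤y⇒≤ (≤-trans xa≤z z≤yb)) (x≤y⇒≤ (≤-trans xb≤z z≤ya))

    rungsMeeting≤width : ∀ {k} t (r : Fin k → Fin m) → Injective _≡_ _≡_ r →
                         (∀ a → Meets t (x (r a)) (y (r a))) → k ℕ.≤ w
    rungsMeeting≤width t r r-inj meets =
      subst (_ ℕ.≤_) (∣A∣≡w t)
        (injection⇒≤∣p∣ (A t) (proj₁ ∘ meets) (proj₁ ∘ proj₂ ∘ meets)
                        (r-inj ∘ meets-sameRung (meets _) (meets _)))

  module _ {x y : Fin (suc (2 * w)) → Fin N} (ladder : IsLadder _≤_ (suc (2 * w)) x y) where

    open Rungs ladder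

    -- suc w + 1 * w and suc (2 * w) are definitionally equal.
    lower : Fin (suc w) → Fin (suc (2 * w))
    lower k = k ↑ˡ (1 * w)

    middle : Fin (suc (2 * w))
    middle = lower (fromℕ w)

    upper-bound : (k : Fin (suc w)) → w ℕ.+ toℕ k ℕ.< suc (2 * w)
    upper-bound k = ℕ.s≤s (ℕₚ.+-monoʳ-≤ w (ℕₚ.≤-trans (Fₚ.toℕ≤pred[n] k) (ℕₚ.m≤m+n w 0)))

    upper : Fin (suc w) → Fin (suc (2 * w))
    upper k = fromℕ< (upper-bound k)

    lower-injective : Injective _≡_ _≡_ lower
    lower-injective = Fₚ.↑ˡ-injective (1 * w) _ _

    upper-injective : Injective _≡_ _≡_ upper
    upper-injective = Fₚ.toℕ-injective ∘ ℕₚ.+-cancelˡ-≡ w _ _ ∘ Fₚ.fromℕ<-injective _ _ _ _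

    lower≤middle : ∀ k → lower k F.≤ middle
    lower≤middle k rewrite Fₚ.toℕ-↑ˡ k (1 * w) | Fₚ.toℕ-↑ˡ (fromℕ w) (1 * w) = Fₚ.≤fromℕ k

    middle≤upper : ∀ k → middle F.≤ upper k
    middle≤upper k = begin
      toℕ middle        ≡⟨ Fₚ.toℕ-↑ˡ (fromℕ w) (1 * w) ⟩
      toℕ (fromℕ w)     ≡⟨ Fₚ.toℕ-fromℕ w ⟩
      w                 ≤⟨ ℕₚ.m≤m+n w (toℕ k) ⟩
      w ℕ.+ toℕ k       ≡⟨ Fₚ.toℕ-fromℕ< (upper-bound k) ⟨
      toℕ (upper k)     ∎
      where open ℕₚ.≤-Reasoning

    Central : Fin n → Set
    Central = Between (X middle) (Y middle)

    lowerRungs-meet : ∀ {i t} → y zero ∈ A i → Central t → LeastIndex Central t → t ⊑ᴬ i →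
                      ∀ k → Meets t (x (lower k)) (y (lower k))
    lowerRungs-meet y₀∈i (Xc⊑t , _) least t⊑i k =
      meets-leastAbove (∈-index _) (∈-index _) (x≤y (lower k))
        (⊑-trans (X⊑X (lower≤middle k)) Xc⊑t , ⊑-trans t⊑i (≤⇒⊑ (y-mono ℕ.z≤n) y₀∈i (∈-index _)))
        λ t′ (t⊑t′ , t′⊑Yk) → least t′ (⊑-trans Xc⊑t t⊑t′ , ⊑-trans t′⊑Yk (Y⊑Y (lower≤middle k)))

    upperRungs-meet : ∀ {i j t} → x (fromℕ (2 * w)) ∈ A j → j ⊑ᴬ i → Central t → LeastIndex Central t →
                      i ⊑ᴬ t → ∀ k → Meets t (x (upper k)) (y (upper k))
    upperRungs-meet xₗ∈j j⊑i (_ , t⊑Yc) least i⊑t k =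
      meets-leastBelow (∈-index _) (∈-index _) (x≤y (upper k))
        (⊑-trans (≤⇒⊑ (x-mono (Fₚ.≤fromℕ (upper k))) (∈-index _) xₗ∈j) (⊑-trans j⊑i i⊑t) ,
         ⊑-trans t⊑Yc (Y⊑Y (middle≤upper k)))
        λ t′ (Xk⊑t′ , t′⊑t) → least t′ (⊑-trans (X⊑X (middle≤upper k)) Xk⊑t′ , ⊑-trans t′⊑t t⊑Yc)

    reversed-impossible : ∀ {i j} → y zero ∈ A i → x (fromℕ (2 * w)) ∈ A j → ¬ (j ⊑ᴬ i)
    reversed-impossible {i} y₀∈i xₗ∈j j⊑i = ¬¬leastIndex (⊑-refl , X⊑Y middle) λ where
      (t , central , least) → ℕₚ.1+n≰n (case linear t i of λ where
        (inj₁ t⊑i) → rungsMeeting≤width t lower lower-injective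
                       (lowerRungs-meet y₀∈i central least t⊑i)
        (inj₂ i⊑t) → rungsMeeting≤width t upper upper-injective
                       (upperRungs-meet xₗ∈j j⊑i central least i⊑t))

proposition4p3 : (N : ℕ) (_≤_ : Rel (Fin N) 0ℓ) → IsPartialOrder _≡_ _≤_ →
    (w n : ℕ) (A : Fin n → Subset N) → IsRegular _≤_ A w →
    (x y : Fin (suc (2 * w)) → Fin N) → IsLadder _≤_ (suc (2 * w)) x y →
    (i j : Fin n) → y zero ∈ A i → x (fromℕ (2 * w)) ∈ A j →
    _⊑_ _≤_ (A i) (A j)
proposition4p3 N _≤_ po w n A reg x y ladder i j y₀∈i xₗ∈j with Regular.linear po reg i j
... | inj₁ i⊑j = i⊑j
... | inj₂ j⊑i = ⊥-elim (Regular.reversed-impossible po reg ladder y₀∈i xₗ∈j j⊑i)
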